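{- Let $k\ge 0$ be an integer and let $\{S^{(k)}_n\}$ be the $k$-Skipponacci numbers. Every integer $x\in\mathbb{Z}$ has a unique far-difference representation by the $k$-Skipponacci numbers in which every two terms of the same sign are at least $2k+2$ apart in index and every two terms of opposite sign are at least $k+2$ apart in index.
   Context: The $k$-Skipponacci numbers are defined by $S^{(k)}_n=0$ for $n\le 0$, $S^{(k)}_i=i$ for $1\le i\le k+1$, and $S^{(k)}_{n+1}=S^{(k)}_n+S^{(k)}_{n-k}$ for $n\ge k+1$ (so $k=0$ gives powers of $2$ and $k=1$ gives the Fibonacci numbers $1,2,3,5,8,\dots$). A far-difference representation of $x$ is an expression $x=\sum_{t}\epsilon_t S^{(k)}_{n_t}$ with $\epsilon_t\in\{ -1,+1\}$ and distinct indices $n_t\ge 1$; the integer $0$ is represented by the empty sum. -}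

module Defs where

open import Data.Nat using (ℕ; zero; suc; _+_; _∸_; _≤_; _<_; _≤?_; s≤s; z≤n)
open import Data.Nat.Properties using (m∸n≤m; ≤-refl)
open import Data.Nat.Induction using (<-rec)
open import Data.Integer using (ℤ; +_; -_) renaming (_+_ to _+ℤ_)
open import Data.List using (List; []; _∷_)
open import Data.List.Relation.Unary.All using (All)
open import Data.Product using (_×_; _,_; proj₁; proj₂)
open import Data.Sign using (Sign) renaming (+ to pos; - to neg)
open import Relation.Nullary using (yes; no)
open import Relation.Binary.PropositionalEquality using (_≡_)

-- The k-Skipponacci numbers S^{(k)}_n (with S^{(k)}_n = 0 for n ≤ 0):
--   S 0 = 0,  S i = i for 1 ≤ i ≤ k+1,
--   S (n+1) = S n + S (n - k) for n ≥ k+1.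
-- For n ≥ k+1 we have n - k ≥ 1, so no non-positive index is used.
private
  n∸k<1+n : ∀ n k → n ∸ k < suc n
  n∸k<1+n n k = s≤s (m∸n≤m n k)

Skip : ℕ → ℕ → ℕ
Skip k = <-rec (λ _ → ℕ) step
  where
  step : (m : ℕ) → ({j : ℕ} → j < m → ℕ) → ℕ
  step zero rec = 0
  step (suc n) rec with suc n ≤? suc k
  ... | yes _ = suc n
  ... | no _ = rec {n} ≤-refl + rec {n ∸ k} (n∸k<1+n n k)

-- A signed term ε · S^{(k)}_n is a pair (ε , n).
Term : Set
Term = Sign × ℕ

signed : Sign → ℕ → ℤ
signed pos m = + m
signed neg m = - (+ m)

value : ℕ → List Term → ℤ
value k [] = + 0
value k ((s , n) ∷ ts) = signed s (Skip k n) +ℤ value k ts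

gapOK : ℕ → Term → Term → Set
gapOK k (s , m) (s′ , n) with s Data.Sign.≟ s′
... | yes _ = m + (2 Data.Nat.* k + 2) ≤ n
... | no _ = m + (k + 2) ≤ n

data FarDiff (k : ℕ) : List Term → Set where
  []  : FarDiff k []
  _∷_ : ∀ {t ts} → (1 ≤ proj₂ t) × All (gapOK k t) ts → FarDiff k ts → FarDiff k (t ∷ ts)

private
  open import Data.List using (map; upTo)
  _ : map (Skip 1) (upTo 8) ≡ 0 ∷ 1 ∷ 2 ∷ 3 ∷ 5 ∷ 8 ∷ 13 ∷ 21 ∷ []
  _ = Relation.Binary.PropositionalEquality.refl
  _ : map (Skip 0) (upTo 6) ≡ 0 ∷ 1 ∷ 2 ∷ 4 ∷ 8 ∷ 16 ∷ []
  _ = Relation.Binary.PropositionalEquality.refl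
  _ : map (Skip 2) (upTo 9) ≡ 0 ∷ 1 ∷ 2 ∷ 3 ∷ 4 ∷ 6 ∷ 9 ∷ 13 ∷ 19 ∷ []
  _ = Relation.Binary.PropositionalEquality.refl

module Submission where

-- Let g = 2k+2 and R n = S n + S (n − g) + S (n − 2g) + ⋯ (positive indices
-- only), the largest value of a far-difference representation whose top
-- index is n.  Everything rests on the identity
--     S (n+1) = 1 + R n + R (n − (k+1))                          (S-via-R)
-- proved by strong induction from the Skipponacci recurrence.  It makes the
-- bands (R (m−1), R m] partition the positive integers and yields:
--   * the top-term lemma: a representation whose largest term is ε·S m has
--     value ε·v with v in band m;
--   * existence: for v in band m, either v − S m ≤ R (m − g) or
--     S m − v ≤ R (m − (k+1)), and a representation of the (smaller)
--     remainder, extended by the term ±S m, represents ±v;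
--   * uniqueness: two representations of x share their top term (by the
--     top-term lemma), which we cancel before recursing.
-- Representations list their terms by increasing index, so they are taken
-- apart at their last term, using the reverse view of lists.

open import Defs
open import Data.Nat using (ℕ; zero; suc; pred; _+_; _*_; _∸_; _≤_; _<_; _≤?_; _≤′_; _<′_; ≤′-refl; ≤′-step; s≤s; s≤s⁻¹; z≤n)
open import Data.Nat.Properties
open import Data.Nat.Induction using (<-rec; <′-wellFounded; <′-wellFounded′)
open import Data.Nat.Tactic.RingSolver using (solve-∀)
open import Data.Integer as ℤ using (ℤ; -[1+_]; -_) renaming (_+_ to _+ℤ_)
import Data.Integer.Properties as ℤ
open import Algebra.Bundles using (AbelianGroup)
open import Algebra.Properties.Group (AbelianGroup.group ℤ.+-0-abelianGroup) using (∙-cancelʳ)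
open import Data.Sign using (Sign; opposite) renaming (+ to pos; - to neg)
open import Data.List using (List; []; _∷_; _∷ʳ_)
open import Data.List.Reverse using (Reverse; []; _∶_∶ʳ_; reverseView)
open import Data.List.Relation.Unary.All using (All; []; _∷_)
import Data.List.Relation.Unary.All as All
open import Data.List.Relation.Unary.All.Properties using (∷ʳ⁺; ∷ʳ⁻)
open import Data.Product using (Σ; _×_; _,_; proj₁; proj₂)
open import Relation.Nullary using (yes; no; contradiction)
open import Relation.Binary.PropositionalEquality

-- Skip is defined by well-founded recursion on _<_.  The accessibility
-- proofs it recurses on reduce to the canonical ones, so the defining
-- equations below hold by computation once these are identified.
acc-canonical : ∀ {j n} (p : j <′ n) → <′-wellFounded′ n p ≡ <′-wellFounded j
acc-canonical ≤′-refl     = refl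
acc-canonical (≤′-step p) = acc-canonical p

Skip-initial : ∀ k n → n ≤ suc k → Skip k n ≡ n
Skip-initial k zero    _  = refl
Skip-initial k (suc n) le with suc n ≤? suc k
... | yes _  = refl
... | no n≰k = contradiction le n≰k

Skip-step : ∀ k n → suc k ≤ n → Skip k (suc n) ≡ Skip k n + Skip k (n ∸ k)
Skip-step k n k<n with suc n ≤? suc k
... | yes n≤k = contradiction (s≤s⁻¹ n≤k) (<⇒≱ k<n)
... | no _ rewrite acc-canonical (<⇒<′ (≤-refl {suc n}))
                 | acc-canonical (<⇒<′ (s≤s (m∸n≤m n k))) = refl

double-suc : ∀ k → 2 * k + 2 ≡ suc k + suc k
double-suc = solve-∀

rotate-sum : ∀ x y z → x + suc (y + z) ≡ suc (x + z + y)
rotate-sum = solve-∀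

∸-positive : ∀ a b → 0 < a ∸ b → a ∸ b + b ≡ a
∸-positive a b 0<a∸b = m∸n+n≡m (<⇒≤ (m∸n≢0⇒n<m {a} {b} (n>0⇒n≢0 0<a∸b)))

signed-surjective : ∀ x → Σ Sign λ σ → Σ ℕ λ v → signed σ v ≡ x
signed-surjective (ℤ.+ n)  = pos , n , refl
signed-surjective -[1+ n ] = neg , suc n , refl

signed-zero : ∀ σ → signed σ 0 ≡ ℤ.+ 0
signed-zero pos = refl
signed-zero neg = refl

signed-+ : ∀ σ a b → signed σ a +ℤ signed σ b ≡ signed σ (a + b)
signed-+ pos a b = refl
signed-+ neg a b = sym (ℤ.neg-distrib-+ (ℤ.+ a) (ℤ.+ b))

signed-∸ : ∀ σ {w a} → w ≤ a → signed (opposite σ) w +ℤ signed σ a ≡ signed σ (a ∸ w)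
signed-∸ pos {w} {a} w≤a = trans (ℤ.-m+n≡n⊖m w a) (ℤ.⊖-≥ w≤a)
signed-∸ neg {w} {a} w≤a = begin
  ℤ.+ w +ℤ - ℤ.+ a          ≡⟨ cong (_+ℤ - ℤ.+ a) (ℤ.neg-involutive (ℤ.+ w)) ⟨
  - - ℤ.+ w +ℤ - ℤ.+ a      ≡⟨ ℤ.neg-distrib-+ (- ℤ.+ w) (ℤ.+ a) ⟨
  - (- ℤ.+ w +ℤ ℤ.+ a)      ≡⟨ cong -_ (signed-∸ pos w≤a) ⟩
  - ℤ.+ (a ∸ w)             ∎
  where open ≡-Reasoning

signed-injective : ∀ σ τ {v w} → 0 < v → signed σ v ≡ signed τ w → σ ≡ τ × v ≡ w
signed-injective pos pos _ eq = refl , ℤ.+-injective eq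
signed-injective neg neg _ eq = refl , ℤ.+-injective (ℤ.neg-injective eq)
signed-injective pos neg {suc v} {zero}  _ ()
signed-injective pos neg {suc v} {suc w} _ ()
signed-injective neg pos {suc v}         _ ()

module Skipponacci (k : ℕ) where

  S : ℕ → ℕ
  S = Skip k

  g : ℕ
  g = suc k + suc k

  -- R n = S n + S (n − g) + S (n − 2g) + ⋯ over positive indices, defined
  -- like Skip by well-founded recursion so that R-step holds by computation.
  R : ℕ → ℕ
  R = <-rec (λ _ → ℕ) sum
    where
    sum : (n : ℕ) → ({j : ℕ} → j < n → ℕ) → ℕ
    sum zero    _   = 0
    sum (suc n) rec = S (suc n) + rec {suc n ∸ g} (s≤s (m∸n≤m n (k + suc k)))

  R-step : ∀ n → R (suc n) ≡ S (suc n) + R (suc n ∸ g)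
  R-step n rewrite acc-canonical (<⇒<′ (s≤s (m∸n≤m n (k + suc k)))) = refl

  -- Below index k+2 only the top term fits, and S i = i there.
  R-initial : ∀ n → n ≤ suc k → R n ≡ n
  R-initial zero    _  = refl
  R-initial (suc n) le = begin
    R (suc n)                  ≡⟨ R-step n ⟩
    S (suc n) + R (suc n ∸ g)  ≡⟨ cong₂ _+_ (Skip-initial k (suc n) le)
                                           (cong R (m≤n⇒m∸n≡0 (≤-trans le (m≤m+n (suc k) (suc k))))) ⟩
    suc n + 0                  ≡⟨ +-identityʳ (suc n) ⟩
    suc n                      ∎
    where open ≡-Reasoning

  S-via-R-initial : ∀ n → n ≤ k → S (suc n) ≡ suc (R n + R (n ∸ suc k))
  S-via-R-initial n n≤k = begin
    S (suc n)                   ≡⟨ Skip-initial k (suc n) (s≤s n≤k) ⟩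
    suc n                       ≡⟨ cong suc (sym (+-identityʳ n)) ⟩
    suc (n + R 0)               ≡⟨ cong₂ (λ a b → suc (a + R b)) (sym (R-initial n (m≤n⇒m≤1+n n≤k)))
                                         (sym (m≤n⇒m∸n≡0 (m≤n⇒m≤1+n n≤k))) ⟩
    suc (R n + R (n ∸ suc k))   ∎
    where open ≡-Reasoning

  S-via-R-step : ∀ a → S (suc a) ≡ suc (R a + R (a ∸ suc k)) →
                 S (suc (suc k + a)) ≡ suc (R (suc k + a) + R (suc k + a ∸ suc k))
  S-via-R-step a IH = begin
    S (suc n)                          ≡⟨ Skip-step k n (m≤m+n (suc k) a) ⟩
    S n + S (n ∸ k)                    ≡⟨ cong (λ i → S n + S i) n∸k≡1+a ⟩
    S n + S (suc a)                    ≡⟨ cong (S n +_) IH ⟩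
    S n + suc (R a + R (a ∸ suc k))    ≡⟨ cong (λ i → S n + suc (R a + R i)) a∸k+1≡n∸g ⟩
    S n + suc (R a + R (n ∸ g))        ≡⟨ rotate-sum (S n) (R a) (R (n ∸ g)) ⟩
    suc (S n + R (n ∸ g) + R a)        ≡⟨ cong (λ r → suc (r + R a)) (sym (R-step (k + a))) ⟩
    suc (R n + R a)                    ≡⟨ cong (λ i → suc (R n + R i)) (sym (m+n∸m≡n (suc k) a)) ⟩
    suc (R n + R (n ∸ suc k))          ∎
    where
    open ≡-Reasoning
    n : ℕ
    n = suc k + a
    n∸k≡1+a : n ∸ k ≡ suc a
    n∸k≡1+a = trans (cong (_∸ k) (sym (+-suc k a))) (m+n∸m≡n k (suc a))
    a∸k+1≡n∸g : a ∸ suc k ≡ n ∸ g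
    a∸k+1≡n∸g = sym ([m+n]∸[m+o]≡n∸o (suc k) a (suc k))

  S-via-R : ∀ n → S (suc n) ≡ suc (R n + R (n ∸ suc k))
  S-via-R = <-rec P step
    where
    P : ℕ → Set
    P n = S (suc n) ≡ suc (R n + R (n ∸ suc k))
    step : ∀ n → (∀ {m} → m < n → P m) → P n
    step n IH with n ≤? k
    ... | yes n≤k = S-via-R-initial n n≤k
    ... | no n≰k  = subst P (m+[n∸m]≡n k<n)
                          (S-via-R-step (n ∸ suc k) (IH (∸-monoʳ-< (s≤s z≤n) k<n)))
      where
      k<n : suc k ≤ n
      k<n = ≰⇒> n≰k

  S≤R : ∀ m → S (suc m) ≤ R (suc m)
  S≤R m = subst (S (suc m) ≤_) (sym (R-step m)) (m≤m+n (S (suc m)) _)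

  R<S : ∀ m → R m < S (suc m)
  R<S m = subst (R m <_) (sym (S-via-R m)) (s≤s (m≤m+n (R m) _))

  R-strict : ∀ n → R n < R (suc n)
  R-strict n = <-≤-trans (R<S n) (S≤R n)

  R-mono : ∀ {m n} → m ≤ n → R m ≤ R n
  R-mono m≤n = go (≤⇒≤′ m≤n)
    where
    go : ∀ {m n} → m ≤′ n → R m ≤ R n
    go ≤′-refl      = ≤-refl
    go (≤′-step le) = ≤-trans (go le) (<⇒≤ (R-strict _))

  R-reflect : ∀ {m n} → R m < R n → m < n
  R-reflect lt = ≰⇒> (λ n≤m → <⇒≱ lt (R-mono n≤m))

  R-grows : ∀ n → n ≤ R n
  R-grows zero    = z≤n
  R-grows (suc n) = <-≤-trans (s≤s (R-grows n)) (R-strict n)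

  R-positive : ∀ {w} i → 0 < w → w ≤ R i → 0 < i
  R-positive zero    0<w w≤0 = contradiction (≤-trans 0<w w≤0) λ ()
  R-positive (suc i) _   _   = s≤s z≤n

  record InBand (m v : ℕ) : Set where
    constructor in-band
    field
      above  : R (pred m) < v
      within : v ≤ R m

  band-positive : ∀ {m v} → InBand m v → 0 < v
  band-positive (in-band lo _) = ≤-trans (s≤s z≤n) lo

  band-of : ∀ {v} → 0 < v → Σ ℕ λ m → InBand (suc m) v
  band-of {v} 0<v = search v (R-grows v)
    where
    search : ∀ n → v ≤ R n → Σ ℕ λ m → InBand (suc m) v
    search zero    v≤R0 = contradiction (R-positive 0 0<v v≤R0) λ ()
    search (suc n) v≤R with v ≤? R n
    ... | yes v≤Rn = search n v≤Rn
    ... | no v≰Rn  = n , in-band (≰⇒> v≰Rn) v≤R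

  band-≤ : ∀ {m v j} → InBand m v → v ≤ R j → m ≤ j
  band-≤ {zero}  _        _   = z≤n
  band-≤ {suc m} (in-band lo _) v≤R = R-reflect (<-≤-trans lo v≤R)

  band-unique : ∀ {m n v} → InBand m v → InBand n v → m ≡ n
  band-unique bm bn = ≤-antisym (band-≤ bm (InBand.within bn)) (band-≤ bn (InBand.within bm))

  -- The recurrences R (m+1) = S (m+1) + R (m+1 − g) and
  -- S (m+1) = 1 + R m + R (m − (k+1)) read as bounds: adding or
  -- subtracting the top term S (m+1) moves between band m+1 and the
  -- admissible remainders of the same resp. opposite sign.
  same-sum-≤ : ∀ {w m} → w ≤ R (suc m ∸ g) → w + S (suc m) ≤ R (suc m)
  same-sum-≤ {w} {m} w≤ = begin
    w + S (suc m)              ≤⟨ +-monoˡ-≤ (S (suc m)) w≤ ⟩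
    R (suc m ∸ g) + S (suc m)  ≡⟨ +-comm (R (suc m ∸ g)) (S (suc m)) ⟩
    S (suc m) + R (suc m ∸ g)  ≡⟨ R-step m ⟨
    R (suc m)                  ∎
    where open ≤-Reasoning

  same-rest-≤ : ∀ {v m} → v ≤ R (suc m) → v ∸ S (suc m) ≤ R (suc m ∸ g)
  same-rest-≤ {v} {m} v≤ = begin
    v ∸ S (suc m)                          ≤⟨ ∸-monoˡ-≤ (S (suc m)) v≤ ⟩
    R (suc m) ∸ S (suc m)                  ≡⟨ cong (_∸ S (suc m)) (R-step m) ⟩
    S (suc m) + R (suc m ∸ g) ∸ S (suc m)  ≡⟨ m+n∸m≡n (S (suc m)) (R (suc m ∸ g)) ⟩
    R (suc m ∸ g)                          ∎
    where open ≤-Reasoning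

  opp-rest-≤S : ∀ {w m} → w ≤ R (m ∸ suc k) → w ≤ S (suc m)
  opp-rest-≤S {w} {m} w≤ = ≤-trans w≤ (subst (R (m ∸ suc k) ≤_) (sym (S-via-R m)) (m≤n+m _ (suc (R m))))

  opp-diff-> : ∀ {w m} → w ≤ R (m ∸ suc k) → R m < S (suc m) ∸ w
  opp-diff-> {w} {m} w≤ = begin-strict
    R m                 <⟨ n<1+n (R m) ⟩
    suc (R m)           ≡⟨ m+n∸n≡m (suc (R m)) B ⟨
    suc (R m) + B ∸ B   ≡⟨ cong (_∸ B) (S-via-R m) ⟨
    S (suc m) ∸ B       ≤⟨ ∸-monoʳ-≤ (S (suc m)) w≤ ⟩
    S (suc m) ∸ w       ∎
    where
    open ≤-Reasoning
    B : ℕ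
    B = R (m ∸ suc k)

  opp-rest-≤ : ∀ {v m} → R m < v → S (suc m) ∸ v ≤ R (m ∸ suc k)
  opp-rest-≤ {v} {m} lt = begin
    S (suc m) ∸ v                         ≤⟨ ∸-monoʳ-≤ (S (suc m)) lt ⟩
    S (suc m) ∸ suc (R m)                 ≡⟨ cong (_∸ suc (R m)) (S-via-R m) ⟩
    suc (R m + R (m ∸ suc k)) ∸ suc (R m) ≡⟨ m+n∸m≡n (R m) (R (m ∸ suc k)) ⟩
    R (m ∸ suc k)                         ∎
    where open ≤-Reasoning

  gap : Sign → Sign → ℕ
  gap pos pos = g
  gap neg neg = g
  gap pos neg = k + 2
  gap neg pos = k + 2

  gapOK-≡ : ∀ σ τ m n → gapOK k (σ , m) (τ , n) ≡ (m + gap σ τ ≤ n)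
  gapOK-≡ pos pos m n = cong (λ d → m + d ≤ n) (double-suc k)
  gapOK-≡ neg neg m n = cong (λ d → m + d ≤ n) (double-suc k)
  gapOK-≡ pos neg m n = refl
  gapOK-≡ neg pos m n = refl

  gap-to : ∀ {σ τ m n} → gapOK k (σ , m) (τ , n) → m + gap σ τ ≤ n
  gap-to {σ} {τ} {m} {n} = subst (λ P → P) (gapOK-≡ σ τ m n)

  gap-from : ∀ {σ τ m n} → m + gap σ τ ≤ n → gapOK k (σ , m) (τ , n)
  gap-from {σ} {τ} {m} {n} = subst (λ P → P) (sym (gapOK-≡ σ τ m n))

  gap-same : ∀ σ → gap σ σ ≡ g
  gap-same pos = refl
  gap-same neg = refl

  gap-opposite : ∀ σ a → a + gap (opposite σ) σ ≡ suc (a + suc k)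
  gap-opposite pos a = trans (cong (a +_) (+-comm k 2)) (+-suc a (suc k))
  gap-opposite neg a = trans (cong (a +_) (+-comm k 2)) (+-suc a (suc k))

  -- Every gap lies between k+2 and g ≤ 2(k+2), so gaps obey the triangle
  -- inequality and the gap condition is transitive.
  gap-≥ : ∀ σ τ → k + 2 ≤ gap σ τ
  gap-≥ pos pos = subst (_≤ g) (+-comm 2 k) (s≤s (m≤n+m (suc k) k))
  gap-≥ neg neg = subst (_≤ g) (+-comm 2 k) (s≤s (m≤n+m (suc k) k))
  gap-≥ pos neg = ≤-refl
  gap-≥ neg pos = ≤-refl

  gap-≤ : ∀ σ τ → gap σ τ ≤ (k + 2) + (k + 2)
  gap-≤ σ τ = ≤-trans (gap-≤g σ τ) (+-mono-≤ k+1≤k+2 k+1≤k+2)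
    where
    k+1≤k+2 : suc k ≤ k + 2
    k+1≤k+2 = subst (suc k ≤_) (+-comm 2 k) (n≤1+n (suc k))
    gap-≤g : ∀ σ τ → gap σ τ ≤ g
    gap-≤g pos pos = ≤-refl
    gap-≤g neg neg = ≤-refl
    gap-≤g pos neg = gap-≥ pos pos
    gap-≤g neg pos = gap-≥ pos pos

  gap-triangle : ∀ τ σ s → gap τ s ≤ gap τ σ + gap σ s
  gap-triangle τ σ s = ≤-trans (gap-≤ τ s) (+-mono-≤ (gap-≥ τ σ) (gap-≥ σ s))

  gapOK-trans : ∀ {t u w} → gapOK k t u → gapOK k u w → gapOK k t w
  gapOK-trans {τ , j} {σ , m} {s , n} t→u u→w = gap-from (begin
    j + gap τ s                    ≤⟨ +-monoʳ-≤ j (gap-triangle τ σ s) ⟩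
    j + (gap τ σ + gap σ s)        ≡⟨ +-assoc j (gap τ σ) (gap σ s) ⟨
    j + gap τ σ + gap σ s          ≤⟨ +-monoˡ-≤ (gap σ s) (gap-to t→u) ⟩
    m + gap σ s                    ≤⟨ gap-to u→w ⟩
    n                              ∎)
    where open ≤-Reasoning

  value-snoc : ∀ xs σ m → value k (xs ∷ʳ (σ , m)) ≡ value k xs +ℤ signed σ (S m)
  value-snoc []             σ m =
    trans (ℤ.+-identityʳ (signed σ (S m))) (sym (ℤ.+-identityˡ (signed σ (S m))))
  value-snoc ((τ , j) ∷ xs) σ m =
    trans (cong (signed τ (S j) +ℤ_) (value-snoc xs σ m)) (sym (ℤ.+-assoc (signed τ (S j)) _ _))

  Below : Term → List Term → Set
  Below t = All (λ u → gapOK k u t)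

  farDiff-snoc⁻ : ∀ xs t → FarDiff k (xs ∷ʳ t) → FarDiff k xs × Below t xs × 1 ≤ proj₂ t
  farDiff-snoc⁻ []       t ((1≤t , []) ∷ []) = [] , [] , 1≤t
  farDiff-snoc⁻ (u ∷ xs) t ((1≤u , u→xs∷t) ∷ fd) with farDiff-snoc⁻ xs t fd | ∷ʳ⁻ u→xs∷t
  ... | fdxs , xs→t , 1≤t | u→xs , u→t = ((1≤u , u→xs) ∷ fdxs) , (u→t ∷ xs→t) , 1≤t

  farDiff-snoc⁺ : ∀ xs t → FarDiff k xs → Below t xs → 1 ≤ proj₂ t → FarDiff k (xs ∷ʳ t)
  farDiff-snoc⁺ []       t []                  []             1≤t = (1≤t , []) ∷ []
  farDiff-snoc⁺ (u ∷ xs) t ((1≤u , u→xs) ∷ fd) (u→t ∷ xs→t) 1≤t =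
    (1≤u , ∷ʳ⁺ u→xs u→t) ∷ farDiff-snoc⁺ xs t fd xs→t 1≤t

  extend-same : ∀ σ {w j m} → w ≤ R j → j + g ≤ suc m →
                Σ ℕ λ v → signed σ w +ℤ signed σ (S (suc m)) ≡ signed σ v × InBand (suc m) v
  extend-same σ {w} {j} {m} w≤Rj j+g≤ =
    w + S (suc m) , signed-+ σ w (S (suc m)) ,
    in-band (<-≤-trans (R<S m) (m≤n+m (S (suc m)) w))
            (same-sum-≤ (≤-trans w≤Rj (R-mono (m+n≤o⇒m≤o∸n j j+g≤))))

  extend-opp : ∀ σ {w j m} → w ≤ R j → j + (k + 2) ≤ suc m →
               Σ ℕ λ v → signed (opposite σ) w +ℤ signed σ (S (suc m)) ≡ signed σ v × InBand (suc m) v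
  extend-opp σ {w} {j} {m} w≤Rj j+k+2≤ =
    S (suc m) ∸ w , signed-∸ σ (opp-rest-≤S {m = m} w≤B) ,
    in-band (opp-diff-> {m = m} w≤B) (≤-trans (m∸n≤m (S (suc m)) w) (S≤R m))
    where
    j+k+2≡ : j + (k + 2) ≡ suc (j + suc k)
    j+k+2≡ = trans (cong (j +_) (+-comm k 2)) (+-suc j (suc k))
    w≤B : w ≤ R (m ∸ suc k)
    w≤B = ≤-trans w≤Rj (R-mono (m+n≤o⇒m≤o∸n j (s≤s⁻¹ (subst (_≤ suc m) j+k+2≡ j+k+2≤))))

  extend : ∀ σ τ {w j m} → w ≤ R j → j + gap τ σ ≤ suc m →
           Σ ℕ λ v → signed τ w +ℤ signed σ (S (suc m)) ≡ signed σ v × InBand (suc m) v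
  extend pos pos {j = j} = extend-same pos {j = j}
  extend neg neg {j = j} = extend-same neg {j = j}
  extend pos neg {j = j} = extend-opp pos {j = j}
  extend neg pos {j = j} = extend-opp neg {j = j}

  top : ∀ {xs} → Reverse xs → ∀ σ m → FarDiff k (xs ∷ʳ (σ , m)) →
        Σ ℕ λ v → value k (xs ∷ʳ (σ , m)) ≡ signed σ v × InBand m v
  top rxs σ m fd with farDiff-snoc⁻ _ (σ , m) fd
  top [] σ (suc m) fd | _ , _ , s≤s z≤n =
    S (suc m) , ℤ.+-identityʳ (signed σ (S (suc m))) , in-band (R<S m) (S≤R m)
  top (ys ∶ rys ∶ʳ (τ , j)) σ (suc m) fd | fdxs , xs→m , s≤s z≤n
    with top rys τ j fdxs | ∷ʳ⁻ xs→m
  ... | w , val-w , (in-band _ w≤Rj) | _ , j→m with extend σ τ w≤Rj (gap-to j→m)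
  ... | v , sum≡v , band = v , val-v , band
    where
    val-v : value k ((ys ∷ʳ (τ , j)) ∷ʳ (σ , suc m)) ≡ signed σ v
    val-v = trans (value-snoc (ys ∷ʳ (τ , j)) σ (suc m))
                  (trans (cong (_+ℤ signed σ (S (suc m))) val-w) sum≡v)

  -- A representation of τ·w with w ≤ R j lies below every term s·S n with
  -- j + gap τ s ≤ n: by the top-term lemma its top term has sign τ and
  -- index at most j, and the gap condition is transitive.
  below-term : ∀ {xs} → Reverse xs → ∀ {τ w j} s n → FarDiff k xs → value k xs ≡ signed τ w →
               w ≤ R j → (0 < w → j + gap τ s ≤ n) → Below (s , n) xs
  below-term [] s n _ _ _ _ = []
  below-term (ys ∶ rys ∶ʳ (σ , m)) {τ} {w} {j} s n fd val w≤Rj far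
    with top rys σ m fd | farDiff-snoc⁻ ys (σ , m) fd
  ... | v , val-v , band | _ , ys→m , _
    with signed-injective σ τ (band-positive band) (trans (sym val-v) val)
  ... | refl , refl = ∷ʳ⁺ (All.map (λ {u} u→m → gapOK-trans {u} u→m m→n) ys→m) m→n
    where
    m→n : gapOK k (σ , m) (s , n)
    m→n = gap-from {σ} {s} {m} {n}
            (≤-trans (+-monoˡ-≤ (gap σ s) (band-≤ band w≤Rj)) (far (band-positive band)))

  Representation : ℤ → Set
  Representation x = Σ (List Term) λ r → FarDiff k r × value k r ≡ x

  append-top : ∀ {w x} σ τ m j → Representation (signed τ w) → w ≤ R j →
               (0 < w → j + gap τ σ ≤ suc m) → signed τ w +ℤ signed σ (S (suc m)) ≡ x →
               Representation x
  append-top σ τ m j (xs , fd , val) w≤Rj far sum≡x =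
    xs ∷ʳ (σ , suc m) ,
    farDiff-snoc⁺ xs (σ , suc m) fd
      (below-term (reverseView xs) {τ} {j = j} σ (suc m) fd val w≤Rj far) (s≤s z≤n) ,
    trans (value-snoc xs σ (suc m)) (trans (cong (_+ℤ signed σ (S (suc m))) val) sum≡x)

  RepresentableBelow : ℕ → Set
  RepresentableBelow v = ∀ {y} → y < v → ∀ ρ → Representation (signed ρ y)

  existence-same : ∀ σ {v m} → RepresentableBelow v → InBand (suc m) v → S (suc m) ≤ v →
                   Representation (signed σ v)
  existence-same σ {v} {m} rec (in-band lo hi) S≤v =
    append-top σ σ m (suc m ∸ g) (rec y<v σ) y≤ far
      (trans (signed-+ σ y (S (suc m))) (cong (signed σ) (m∸n+n≡m S≤v)))
    where
    y : ℕ
    y = v ∸ S (suc m)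
    y≤ : y ≤ R (suc m ∸ g)
    y≤ = same-rest-≤ {m = m} hi
    y<v : y < v
    y<v = ≤-<-trans (≤-trans y≤ (R-mono (m∸n≤m m (k + suc k)))) lo
    far : 0 < y → suc m ∸ g + gap σ σ ≤ suc m
    far 0<y = ≤-reflexive (trans (cong (suc m ∸ g +_) (gap-same σ))
                                 (∸-positive (suc m) g (R-positive (suc m ∸ g) 0<y y≤)))

  existence-opp : ∀ σ {v m} → RepresentableBelow v → InBand (suc m) v → v ≤ S (suc m) →
                  Representation (signed σ v)
  existence-opp σ {v} {m} rec (in-band lo hi) v≤S =
    append-top σ (opposite σ) m (m ∸ suc k) (rec w<v (opposite σ)) w≤ far
      (trans (signed-∸ σ (m∸n≤m (S (suc m)) v)) (cong (signed σ) (m∸[m∸n]≡n v≤S)))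
    where
    w : ℕ
    w = S (suc m) ∸ v
    w≤ : w ≤ R (m ∸ suc k)
    w≤ = opp-rest-≤ {m = m} lo
    w<v : w < v
    w<v = ≤-<-trans (≤-trans w≤ (R-mono (m∸n≤m m (suc k)))) lo
    far : 0 < w → m ∸ suc k + gap (opposite σ) σ ≤ suc m
    far 0<w = ≤-reflexive (trans (gap-opposite σ (m ∸ suc k))
                                 (cong suc (∸-positive m (suc k) (R-positive (m ∸ suc k) 0<w w≤))))

  existence : ∀ v σ → Representation (signed σ v)
  existence = <-rec (λ v → ∀ σ → Representation (signed σ v)) step
    where
    step : ∀ v → RepresentableBelow v → ∀ σ → Representation (signed σ v)
    step zero    _   σ = [] , [] , sym (signed-zero σ)
    step (suc v) rec σ with band-of {suc v} (s≤s z≤n)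
    ... | m , band with S (suc m) ≤? suc v
    ... | yes S≤v = existence-same σ rec band S≤v
    ... | no S≰v  = existence-opp σ rec band (<⇒≤ (≰⇒> S≰v))

  nonempty-nonzero : ∀ {xs} → Reverse xs → ∀ σ m → FarDiff k (xs ∷ʳ (σ , m)) →
                     value k (xs ∷ʳ (σ , m)) ≢ ℤ.+ 0
  nonempty-nonzero rxs σ m fd val≡0 with top rxs σ m fd
  ... | v , val-v , band =
    <⇒≢ (band-positive band)
        (sym (proj₂ (signed-injective σ pos (band-positive band) (trans (sym val-v) val≡0))))

  -- Uniqueness: equal values force equal top terms (top-term lemma and
  -- disjointness of bands); cancel them and recurse.
  uniqueness : ∀ {r r′} → Reverse r → Reverse r′ → FarDiff k r → FarDiff k r′ →
               value k r ≡ value k r′ → r ≡ r′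
  uniqueness [] [] _ _ _ = refl
  uniqueness [] (ys ∶ rys ∶ʳ (τ , n)) _ fd′ val = contradiction (sym val) (nonempty-nonzero rys τ n fd′)
  uniqueness (xs ∶ rxs ∶ʳ (σ , m)) [] fd _ val = contradiction val (nonempty-nonzero rxs σ m fd)
  uniqueness (xs ∶ rxs ∶ʳ (σ , m)) (ys ∶ rys ∶ʳ (τ , n)) fd fd′ val
    with top rxs σ m fd | top rys τ n fd′
  ... | v , val-v , band-v | w , val-w , band-w
    with signed-injective σ τ (band-positive band-v) (trans (sym val-v) (trans val val-w))
  ... | refl , refl with band-unique band-v band-w
  ... | refl = cong (_∷ʳ (σ , m)) (uniqueness rxs rys fdxs fdys val-rest)
    where
    fdxs : FarDiff k xs
    fdxs = proj₁ (farDiff-snoc⁻ xs (σ , m) fd)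
    fdys : FarDiff k ys
    fdys = proj₁ (farDiff-snoc⁻ ys (σ , m) fd′)
    val-rest : value k xs ≡ value k ys
    val-rest = ∙-cancelʳ (signed σ (S m)) (value k xs) (value k ys)
                 (trans (sym (value-snoc xs σ m)) (trans val (value-snoc ys σ m)))

open Skipponacci using (existence; uniqueness)

theorem1p6 : (k : ℕ) → (x : ℤ) →
    Σ (List Term) (λ r → (FarDiff k r × value k r ≡ x) ×
      ((r′ : List Term) → FarDiff k r′ → value k r′ ≡ x → r′ ≡ r))
theorem1p6 k x with signed-surjective x
... | σ , v , refl with existence k v σ
... | r , fd , val = r , (fd , val) , λ r′ fd′ val′ →
  uniqueness k (reverseView r′) (reverseView r) fd′ fd (trans val′ (sym val))
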